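{- (i) For every $n \ge 4$ and every $i$ with $n-2 \le i \le n$, $d_w(C_n, i) = \binom{n}{i}$. (ii) For every $n \ge 6$, $d_w(C_n, n-3) = \frac{(n+1)n(n-4)}{6}$.
   Context: All graphs are finite and simple. For a connected graph $G$, a non-empty set $S \subseteq V(G)$ is a weakly connected dominating set of $G$ if the spanning subgraph of $G$ obtained by removing all edges joining two vertices of $V(G)\setminus S$ is connected. $d_w(G,i)$ is the number of weakly connected dominating sets of $G$ of cardinality $i$. $C_n$ is the cycle with vertex set $\{1,\dots,n\}$ and edges $\{k,k+1\}$ ($1\le k\le n-1$) and $\{n,1\}$. -}

module Defs where

open import Data.Nat using (ℕ; zero; suc)
open import Data.Fin using (Fin; toℕ)
open import Data.Fin.Subset using (Subset; _∈_; ∣_∣; Nonempty)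
open import Data.List using (List; length)
open import Data.List.Relation.Unary.Unique.Propositional using (Unique)
import Data.List.Membership.Propositional as LM
open import Data.Product using (Σ; _×_)
open import Data.Sum using (_⊎_)
open import Function.Bundles using (_⇔_)
open import Relation.Binary.PropositionalEquality using (_≡_)

-- A graph on vertex set Fin n is given by its (symmetric, irreflexive) adjacency relation.

-- The cycle C_n, with vertices 0,…,n-1 (vertex k here is vertex k+1 of the paper):
-- edges {k, k+1} for k+1 < n, and the closing edge {n-1, 0}.
CycleAdj : (n : ℕ) → Fin n → Fin n → Set
CycleAdj n u v =
  (suc (toℕ u) ≡ toℕ v) ⊎ (suc (toℕ v) ≡ toℕ u)
  ⊎ (toℕ u ≡ 0 × suc (toℕ v) ≡ n) ⊎ (toℕ v ≡ 0 × suc (toℕ u) ≡ n)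

data Reach {n : ℕ} (E : Fin n → Fin n → Set) : Fin n → Fin n → Set where
  here : ∀ {u} → Reach E u u
  step : ∀ {u v w} → E u v → Reach E v w → Reach E u w

Connected : {n : ℕ} → (Fin n → Fin n → Set) → Set
Connected E = ∀ u v → Reach E u v

WeakSub : {n : ℕ} → (Fin n → Fin n → Set) → Subset n → Fin n → Fin n → Set
WeakSub E S u v = E u v × (u ∈ S ⊎ v ∈ S)

IsWCDS : {n : ℕ} → (Fin n → Fin n → Set) → Subset n → Set
IsWCDS E S = Nonempty S × Connected (WeakSub E S)

-- DwCount E i k : "d_w(G, i) = k", i.e. the weakly connected dominating sets of G
-- of cardinality i can be listed without repetition in a list of length exactly k.
DwCount : {n : ℕ} → (Fin n → Fin n → Set) → ℕ → ℕ → Set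
DwCount {n} E i k =
  Σ (List (Subset n)) λ xs →
    Unique xs × (∀ S → (S LM.∈ xs) ⇔ (IsWCDS E S × ∣ S ∣ ≡ i)) × length xs ≡ k

module Submission where

-- Vertices of C_n (n = suc m) are the elements of Fin n; rot k is rotation by k
-- (x ↦ x + k mod n) and the edges of C_n are the pairs {x, next x}, next = rot 1.
-- For S ⊆ V(C_n) the edge {a, next a} survives in the weak subgraph iff a ∈ S or
-- next a ∈ S; call a "dead" otherwise.  After enumerating k-subsets, a little
-- subset counting and reachability, the module Cycle proves:
--   * rotations act freely and transitively on the vertices;
--   * if at most one edge is dead, the weak subgraph is connected: walking
--     forwards from the vertex after the dead edge reaches every vertex;
--   * if a, next a and next (next a) are all outside S ("isolated
--     configuration"), the vertex next a has no edge, so S is not a WCDS;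
--   * if at most three vertices are missing from S and there is no isolated
--     configuration, two dead edges coincide (otherwise four distinct vertices
--     are missing), so S is a WCDS.
-- (i) For |S| ≥ n - 2 there is no isolated configuration: every such S is a WCDS.
-- (ii) For |S| = n - 3 the non-WCDSs are exactly the n distinct sets
--      V ∖ {a, a+1, a+2}, so d_w(C_n, n-3) = C(n,3) - n = (n+1)n(n-4)/6.

open import Defs
open import Data.Nat using (ℕ; NonZero; zero; suc; _+_; _*_; _∸_; _≤_; _<_; _/_; z≤n; s≤s; s≤s⁻¹)
open import Data.Nat.Properties hiding (_≟_)
open import Data.Nat.DivMod using (_%_; m%n<n; m<n⇒m%n≡m; m%n%n≡m%n; %-distribˡ-+; [m+n]%n≡m%n; n%n≡0; m*n/n≡m)
open import Data.Nat.Combinatorics using (_C_; nCk+nC[k+1]≡[n+1]C[k+1]; nC1≡n; nCk≡nC[n∸k])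
open import Data.Nat.Tactic.RingSolver using (solve-∀)
open import Data.Fin using (Fin; zero; suc; toℕ; fromℕ<)
open import Data.Fin.Properties using (toℕ-fromℕ<; toℕ-injective; toℕ<n; any?; _≟_)
open import Data.Fin.Subset using (Subset; inside; outside; _∈_; _∉_; ∣_∣; Nonempty; ⊤; ∁; _-_)
open import Data.Fin.Subset.Properties
  using (_∈?_; ∈⊤; ∣⊤∣≡n; ∣⊥∣≡0; ∣∁p∣≡n∸∣p∣; ∣p∣≤n; x∉p⇒x∈∁p; x∈p∧x≢y⇒x∈p-y; x∈p⇒∣p-x∣<∣p∣;
         nonempty?; Empty-unique; ⊆-antisym; p─⊥≡p)
open import Data.Vec using (_∷_; [])
open import Data.Vec.Base using (here; there)
open import Data.Vec.Properties using (∷-injectiveʳ)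
open import Data.List using (List; []; _∷_; [_]; _++_; map; length; filter; tabulate)
open import Data.List.Properties using (length-++; length-map; length-tabulate)
import Data.List.Membership.Propositional as L
open import Data.List.Membership.Propositional.Properties
  using (∈-map⁺; ∈-map⁻; ∈-++⁺ˡ; ∈-++⁺ʳ; ∈-++⁻; ∈-filter⁺; ∈-filter⁻; ∈-tabulate⁺; ∈-tabulate⁻)
open import Data.List.Membership.Propositional.Properties.WithK using (unique∧set⇒bag)
open import Data.List.Relation.Binary.BagAndSetEquality using (∼bag⇒↭)
open import Data.List.Relation.Binary.Permutation.Propositional.Properties using (↭-length)
open import Data.List.Relation.Unary.All as All using (All; []; _∷_)
import Data.List.Relation.Unary.AllPairs as AllPairs
open import Data.List.Relation.Unary.Any using (here; there)
open import Data.List.Relation.Unary.Unique.Propositional using (Unique)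
import Data.List.Relation.Unary.Unique.Propositional.Properties as Unique
open import Data.Product using (Σ; ∃; _×_; _,_; proj₁; proj₂)
open import Data.Sum using (_⊎_; inj₁; inj₂)
open import Data.Empty using (⊥-elim)
open import Function.Bundles using (_⇔_; mk⇔)
open import Relation.Binary.PropositionalEquality using (_≡_; _≢_; refl; sym; trans; cong; cong₂; subst; module ≡-Reasoning)
open import Relation.Nullary using (¬_; Dec; yes; no)
open import Relation.Nullary.Decidable using (_×-dec_; ¬?)
open import Relation.Unary using (Pred; Decidable)
open import Level using (0ℓ)

-- Enumerating the k-element subsets of Fin n

subsets : (n k : ℕ) → List (Subset n)
subsets zero    zero    = [ [] ]
subsets zero    (suc k) = []
subsets (suc n) zero    = map (outside ∷_) (subsets n zero)
subsets (suc n) (suc k) = map (outside ∷_) (subsets n (suc k)) ++ map (inside ∷_) (subsets n k)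

length-subsets : ∀ n k → length (subsets n k) ≡ n C k
length-subsets zero    zero    = refl
length-subsets zero    (suc k) = refl
length-subsets (suc n) zero    = trans (length-map _ (subsets n zero)) (length-subsets n zero)
length-subsets (suc n) (suc k) = begin
  length (map (outside ∷_) (subsets n (suc k)) ++ map (inside ∷_) (subsets n k))
    ≡⟨ length-++ (map (outside ∷_) (subsets n (suc k))) ⟩
  length (map (outside ∷_) (subsets n (suc k))) + length (map (inside ∷_) (subsets n k))
    ≡⟨ cong₂ _+_ (length-map _ (subsets n (suc k))) (length-map _ (subsets n k)) ⟩
  length (subsets n (suc k)) + length (subsets n k)
    ≡⟨ cong₂ _+_ (length-subsets n (suc k)) (length-subsets n k) ⟩
  n C suc k + n C k
    ≡⟨ +-comm (n C suc k) (n C k) ⟩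
  n C k + n C suc k
    ≡⟨ nCk+nC[k+1]≡[n+1]C[k+1] n k ⟩
  suc n C suc k ∎
  where open ≡-Reasoning

∈subsets⇒card : ∀ n k S → S L.∈ subsets n k → ∣ S ∣ ≡ k
∈subsets⇒card zero    zero    [] _ = refl
∈subsets⇒card (suc n) zero    S S∈ with ∈-map⁻ (outside ∷_) S∈
... | T , T∈ , refl = ∈subsets⇒card n zero T T∈
∈subsets⇒card (suc n) (suc k) S S∈ with ∈-++⁻ (map (outside ∷_) (subsets n (suc k))) S∈
... | inj₁ S∈out with ∈-map⁻ (outside ∷_) S∈out
...   | T , T∈ , refl = ∈subsets⇒card n (suc k) T T∈
∈subsets⇒card (suc n) (suc k) S S∈ | inj₂ S∈in with ∈-map⁻ (inside ∷_) S∈in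
...   | T , T∈ , refl = cong suc (∈subsets⇒card n k T T∈)

card⇒∈subsets : ∀ n k S → ∣ S ∣ ≡ k → S L.∈ subsets n k
card⇒∈subsets zero    zero    []            _ = here refl
card⇒∈subsets (suc n) zero    (outside ∷ T) e = ∈-map⁺ (outside ∷_) (card⇒∈subsets n zero T e)
card⇒∈subsets (suc n) (suc k) (outside ∷ T) e =
  ∈-++⁺ˡ (∈-map⁺ (outside ∷_) (card⇒∈subsets n (suc k) T e))
card⇒∈subsets (suc n) (suc k) (inside ∷ T) e =
  ∈-++⁺ʳ (map (outside ∷_) (subsets n (suc k))) (∈-map⁺ (inside ∷_) (card⇒∈subsets n k T (suc-injective e)))

unique-subsets : ∀ n k → Unique (subsets n k)
unique-subsets zero    zero    = AllPairs._∷_ [] AllPairs.[]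
unique-subsets zero    (suc k) = AllPairs.[]
unique-subsets (suc n) zero    = Unique.map⁺ ∷-injectiveʳ (unique-subsets n zero)
unique-subsets (suc n) (suc k) =
  Unique.++⁺ (Unique.map⁺ ∷-injectiveʳ (unique-subsets n (suc k)))
             (Unique.map⁺ ∷-injectiveʳ (unique-subsets n k)) disjoint
  where
  disjoint : ∀ {S} → ¬ (S L.∈ map (outside ∷_) (subsets n (suc k)) × S L.∈ map (inside ∷_) (subsets n k))
  disjoint (S∈out , S∈in) with ∈-map⁻ (outside ∷_) S∈out | ∈-map⁻ (inside ∷_) S∈in
  ... | _ , _ , refl | _ , _ , ()

unique-same-length : ∀ {A : Set} {xs ys : List A} → Unique xs → Unique ys →
                     (∀ x → x L.∈ xs → x L.∈ ys) → (∀ x → x L.∈ ys → x L.∈ xs) →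
                     length xs ≡ length ys
unique-same-length uxs uys xs⊆ys ys⊆xs =
  ↭-length (∼bag⇒↭ (unique∧set⇒bag uxs uys (mk⇔ (xs⊆ys _) (ys⊆xs _))))

length-filter-split : ∀ {A : Set} {P : Pred A 0ℓ} (P? : Decidable P) (xs : List A) →
                      length (filter P? xs) + length (filter (λ x → ¬? (P? x)) xs) ≡ length xs
length-filter-split P? [] = refl
length-filter-split P? (x ∷ xs) with P? x
... | yes _ = cong suc (length-filter-split P? xs)
... | no  _ = trans (+-suc _ _) (cong suc (length-filter-split P? xs))

unique-⊆-bound : ∀ {n} (xs : List (Fin n)) (p : Subset n) → Unique xs → All (_∈ p) xs → length xs ≤ ∣ p ∣
unique-⊆-bound []       p _ _ = z≤n
unique-⊆-bound (x ∷ xs) p (x∉xs AllPairs.∷ uxs) (x∈p ∷ xs⊆p) =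
  <-≤-trans (s≤s (unique-⊆-bound xs (p - x) uxs (All.zipWith stillIn (x∉xs , xs⊆p))))
            (x∈p⇒∣p-x∣<∣p∣ x∈p)
  where stillIn : ∀ {y} → x ≢ y × y ∈ p → y ∈ p - x
        stillIn (x≢y , y∈p) = x∈p∧x≢y⇒x∈p-y y∈p (λ y≡x → x≢y (sym y≡x))

missing-bound : ∀ {n} (xs : List (Fin n)) (S : Subset n) → Unique xs → All (_∉ S) xs → ∣ S ∣ + length xs ≤ n
missing-bound {n} xs S uxs xs∉S = begin
  ∣ S ∣ + length xs     ≤⟨ +-monoʳ-≤ ∣ S ∣ (unique-⊆-bound xs (∁ S) uxs (All.map x∉p⇒x∈∁p xs∉S)) ⟩
  ∣ S ∣ + ∣ ∁ S ∣       ≡⟨ cong (∣ S ∣ +_) (∣∁p∣≡n∸∣p∣ S) ⟩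
  ∣ S ∣ + (n ∸ ∣ S ∣)   ≡⟨ m+[n∸m]≡n (∣p∣≤n S) ⟩
  n                     ∎
  where open ≤-Reasoning

card-remove : ∀ {n} (p : Subset n) {x} → x ∈ p → suc ∣ p - x ∣ ≡ ∣ p ∣
card-remove (inside  ∷ p) here        = cong (λ q → suc ∣ q ∣) (p─⊥≡p p)
card-remove (outside ∷ p) (there x∈p) = card-remove p x∈p
card-remove (inside  ∷ p) (there x∈p) = cong suc (card-remove p x∈p)

∈-remove⁻ : ∀ {n} (p : Subset n) {x y} → y ∈ p - x → y ∈ p × y ≢ x
∈-remove⁻ (inside ∷ p) {suc x} here        = here , λ ()
∈-remove⁻ (_      ∷ p) {zero}  (there y∈) = there (subst (_ ∈_) (p─⊥≡p p) y∈) , λ ()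
∈-remove⁻ (_      ∷ p) {suc x} (there y∈) with ∈-remove⁻ p y∈
... | y∈p , y≢x = there y∈p , λ { refl → y≢x refl }

nonempty-of-card : ∀ {n} (S : Subset n) → 0 < ∣ S ∣ → Nonempty S
nonempty-of-card {n} S 0<∣S∣ with nonempty? S
... | yes ne = ne
... | no  em = ⊥-elim (<⇒≢ 0<∣S∣ (sym (trans (cong ∣_∣ (Empty-unique em)) (∣⊥∣≡0 n))))

distinct3 : ∀ {A : Set} {a b c : A} → a ≢ b → a ≢ c → b ≢ c → Unique (a ∷ b ∷ c ∷ [])
distinct3 ab ac bc = (ab ∷ ac ∷ []) AllPairs.∷ (bc ∷ []) AllPairs.∷ [] AllPairs.∷ AllPairs.[]

distinct4 : ∀ {A : Set} {a b c d : A} → a ≢ b → a ≢ c → a ≢ d → b ≢ c → b ≢ d → c ≢ d →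
            Unique (a ∷ b ∷ c ∷ d ∷ [])
distinct4 ab ac ad bc bd cd =
  (ab ∷ ac ∷ ad ∷ []) AllPairs.∷ (bc ∷ bd ∷ []) AllPairs.∷ (cd ∷ []) AllPairs.∷ [] AllPairs.∷ AllPairs.[]

-- Reachability in graphs

first-edge : ∀ {n} {E : Fin n → Fin n → Set} {u v} → Reach E u v → u ≢ v → ∃ (E u)
first-edge here         u≢u = ⊥-elim (u≢u refl)
first-edge (step e _)   _   = _ , e

module Symmetric {n : ℕ} (E : Fin n → Fin n → Set) (E-sym : ∀ {u v} → E u v → E v u) where

  Reach-trans : ∀ {u v w} → Reach E u v → Reach E v w → Reach E u w
  Reach-trans here       r = r
  Reach-trans (step e q) r = step e (Reach-trans q r)

  Reach-sym : ∀ {u v} → Reach E u v → Reach E v u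
  Reach-sym here       = here
  Reach-sym (step e r) = Reach-trans (Reach-sym r) (step (E-sym e) here)

  connected-from : (z : Fin n) → (∀ u → Reach E z u) → Connected E
  connected-from z z↝ u v = Reach-trans (Reach-sym (z↝ u)) (z↝ v)

CycleAdj-sym : ∀ {n} {u v : Fin n} → CycleAdj n u v → CycleAdj n v u
CycleAdj-sym (inj₁ e)                = inj₂ (inj₁ e)
CycleAdj-sym (inj₂ (inj₁ e))         = inj₁ e
CycleAdj-sym (inj₂ (inj₂ (inj₁ e))) = inj₂ (inj₂ (inj₂ e))
CycleAdj-sym (inj₂ (inj₂ (inj₂ e))) = inj₂ (inj₂ (inj₁ e))

-- Rotations of the cycle C_(suc m)

%-absorbˡ : ∀ a b d .{{_ : NonZero d}} → (a % d + b) % d ≡ (a + b) % d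
%-absorbˡ a b d = begin
  (a % d + b) % d            ≡⟨ %-distribˡ-+ (a % d) b d ⟩
  (a % d % d + b % d) % d    ≡⟨ cong (λ t → (t + b % d) % d) (m%n%n≡m%n a d) ⟩
  (a % d + b % d) % d        ≡⟨ %-distribˡ-+ a b d ⟨
  (a + b) % d                ∎
  where open ≡-Reasoning

module Cycle (m : ℕ) where

  Vertex : Set
  Vertex = Fin (suc m)

  rot : ℕ → Vertex → Vertex
  rot k x = fromℕ< (m%n<n (toℕ x + k) (suc m))

  toℕ-rot : ∀ k x → toℕ (rot k x) ≡ (toℕ x + k) % suc m
  toℕ-rot k x = toℕ-fromℕ< (m%n<n (toℕ x + k) (suc m))

  toℕ%n : ∀ (x : Vertex) → toℕ x % suc m ≡ toℕ x
  toℕ%n x = m<n⇒m%n≡m (toℕ<n x)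

  rot-zero : ∀ x → rot 0 x ≡ x
  rot-zero x = toℕ-injective (begin
    toℕ (rot 0 x)        ≡⟨ toℕ-rot 0 x ⟩
    (toℕ x + 0) % suc m  ≡⟨ cong (_% suc m) (+-identityʳ (toℕ x)) ⟩
    toℕ x % suc m        ≡⟨ toℕ%n x ⟩
    toℕ x                ∎)
    where open ≡-Reasoning

  rot-full : ∀ x → rot (suc m) x ≡ x
  rot-full x = toℕ-injective (begin
    toℕ (rot (suc m) x)       ≡⟨ toℕ-rot (suc m) x ⟩
    (toℕ x + suc m) % suc m   ≡⟨ [m+n]%n≡m%n (toℕ x) (suc m) ⟩
    toℕ x % suc m             ≡⟨ toℕ%n x ⟩
    toℕ x                     ∎)
    where open ≡-Reasoning

  rot-rot : ∀ k l x → rot k (rot l x) ≡ rot (l + k) x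
  rot-rot k l x = toℕ-injective (begin
    toℕ (rot k (rot l x))                        ≡⟨ toℕ-rot k (rot l x) ⟩
    (toℕ (rot l x) + k) % suc m                  ≡⟨ cong (λ t → (t + k) % suc m) (toℕ-rot l x) ⟩
    ((toℕ x + l) % suc m + k) % suc m            ≡⟨ %-absorbˡ (toℕ x + l) k (suc m) ⟩
    (toℕ x + l + k) % suc m                      ≡⟨ cong (_% suc m) (+-assoc (toℕ x) l k) ⟩
    (toℕ x + (l + k)) % suc m                    ≡⟨ toℕ-rot (l + k) x ⟨
    toℕ (rot (l + k) x)                          ∎)
    where open ≡-Reasoning

  rot-onto : ∀ x y → Σ ℕ λ j → j < suc m × rot j x ≡ y
  rot-onto x y = j , m%n<n b (suc m) , toℕ-injective (begin
    toℕ (rot j x)                           ≡⟨ toℕ-rot j x ⟩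
    (toℕ x + j) % suc m                     ≡⟨ cong (λ t → (t + j) % suc m) (toℕ%n x) ⟨
    (toℕ x % suc m + b % suc m) % suc m     ≡⟨ %-distribˡ-+ (toℕ x) b (suc m) ⟨
    (toℕ x + b) % suc m                     ≡⟨ cong (_% suc m) x+b≡y+n ⟩
    (toℕ y + suc m) % suc m                 ≡⟨ [m+n]%n≡m%n (toℕ y) (suc m) ⟩
    toℕ y % suc m                           ≡⟨ toℕ%n y ⟩
    toℕ y                                   ∎)
    where
    open ≡-Reasoning
    b : ℕ
    b = toℕ y + (suc m ∸ toℕ x)
    j : ℕ
    j = b % suc m
    x+b≡y+n : toℕ x + b ≡ toℕ y + suc m
    x+b≡y+n = begin
      toℕ x + (toℕ y + (suc m ∸ toℕ x))   ≡⟨ +-assoc (toℕ x) (toℕ y) _ ⟨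
      toℕ x + toℕ y + (suc m ∸ toℕ x)     ≡⟨ cong (_+ (suc m ∸ toℕ x)) (+-comm (toℕ x) (toℕ y)) ⟩
      toℕ y + toℕ x + (suc m ∸ toℕ x)     ≡⟨ +-assoc (toℕ y) (toℕ x) _ ⟩
      toℕ y + (toℕ x + (suc m ∸ toℕ x))   ≡⟨ cong (toℕ y +_) (m+[n∸m]≡n (<⇒≤ (toℕ<n x))) ⟩
      toℕ y + suc m                       ∎

  -- Rotations act freely: a rotation by an angle below n fixing any vertex is
  -- trivial.  Conjugating by the rotation taking x to 0 reduces this to x = 0.
  rot-fixed : ∀ k x → k < suc m → rot k x ≡ x → k ≡ 0
  rot-fixed k x k<n k-fixes-x with rot-onto x zero
  ... | j , _ , x↦0 = begin
    k                    ≡⟨ m<n⇒m%n≡m k<n ⟨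
    k % suc m            ≡⟨ toℕ-rot k zero ⟨
    toℕ (rot k zero)     ≡⟨ cong toℕ k-fixes-0 ⟩
    0                    ∎
    where
    open ≡-Reasoning
    k-fixes-0 : rot k zero ≡ zero
    k-fixes-0 = begin
      rot k zero        ≡⟨ cong (rot k) x↦0 ⟨
      rot k (rot j x)   ≡⟨ rot-rot k j x ⟩
      rot (j + k) x     ≡⟨ cong (λ t → rot t x) (+-comm j k) ⟩
      rot (k + j) x     ≡⟨ rot-rot j k x ⟨
      rot j (rot k x)   ≡⟨ cong (rot j) k-fixes-x ⟩
      rot j x           ≡⟨ x↦0 ⟩
      zero              ∎

  -- Every rotation by at most n is undone by the complementary rotation.
  rot-injective : ∀ {k x y} → k ≤ suc m → rot k x ≡ rot k y → x ≡ y
  rot-injective {k} {x} {y} k≤n rx≡ry = begin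
    x                             ≡⟨ undo x ⟨
    rot (suc m ∸ k) (rot k x)     ≡⟨ cong (rot (suc m ∸ k)) rx≡ry ⟩
    rot (suc m ∸ k) (rot k y)     ≡⟨ undo y ⟩
    y                             ∎
    where
    open ≡-Reasoning
    undo : ∀ z → rot (suc m ∸ k) (rot k z) ≡ z
    undo z = trans (rot-rot (suc m ∸ k) k z) (trans (cong (λ t → rot t z) (m+[n∸m]≡n k≤n)) (rot-full z))

  next : Vertex → Vertex
  next = rot 1

  next-injective : ∀ {x y} → next x ≡ next y → x ≡ y
  next-injective = rot-injective (s≤s z≤n)

  next-moves : 1 ≤ m → ∀ x → next x ≢ x
  next-moves 1≤m x e = 1+n≢0 (rot-fixed 1 x (s≤s 1≤m) e)

  next²-moves : 2 ≤ m → ∀ x → next (next x) ≢ x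
  next²-moves 2≤m x e = 1+n≢0 (rot-fixed 2 x (s≤s 2≤m) (trans (sym (rot-rot 1 1 x)) e))

  toℕ-next : ∀ x → toℕ (next x) ≡ suc (toℕ x) % suc m
  toℕ-next x = trans (toℕ-rot 1 x) (cong (_% suc m) (+-comm (toℕ x) 1))

  adj-next : ∀ x → CycleAdj (suc m) x (next x)
  adj-next x with m≤n⇒m<n∨m≡n (s≤s⁻¹ (toℕ<n x))
  ... | inj₁ x<m = inj₁ (sym (trans (toℕ-next x) (m<n⇒m%n≡m (s≤s x<m))))
  ... | inj₂ x≡m = inj₂ (inj₂ (inj₂ (wraps , cong suc x≡m)))
    where
    wraps : toℕ (next x) ≡ 0
    wraps = trans (toℕ-next x) (trans (cong (λ t → suc t % suc m) x≡m) (n%n≡0 (suc m)))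

  succ-is-next : ∀ u w → suc (toℕ u) ≡ toℕ w → w ≡ next u
  succ-is-next u w e = toℕ-injective (sym (trans (toℕ-next u) (trans (cong (_% suc m) e) (toℕ%n w))))

  wrap-is-next : ∀ u w → toℕ w ≡ 0 → suc (toℕ u) ≡ suc m → w ≡ next u
  wrap-is-next u w w≡0 e = toℕ-injective (trans w≡0 (sym (trans (toℕ-next u) (trans (cong (_% suc m) e) (n%n≡0 (suc m))))))

  adj⇒next : ∀ {x v} → CycleAdj (suc m) x v → v ≡ next x ⊎ x ≡ next v
  adj⇒next {x} {v} (inj₁ e)                        = inj₁ (succ-is-next x v e)
  adj⇒next {x} {v} (inj₂ (inj₁ e))                 = inj₂ (succ-is-next v x e)
  adj⇒next {x} {v} (inj₂ (inj₂ (inj₁ (x≡0 , e)))) = inj₂ (wrap-is-next v x x≡0 e)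
  adj⇒next {x} {v} (inj₂ (inj₂ (inj₂ (v≡0 , e)))) = inj₁ (wrap-is-next x v v≡0 e)

  -- a, next a and next (next a) all lie outside S: then next a has no edge in
  -- the weak subgraph.
  Isolated : Subset (suc m) → Vertex → Set
  Isolated S a = a ∉ S × next a ∉ S × next (next a) ∉ S

  isolated? : (S : Subset (suc m)) → Dec (∃ (Isolated S))
  isolated? S = any? λ a → ¬? (a ∈? S) ×-dec ¬? (next a ∈? S) ×-dec ¬? (next (next a) ∈? S)

  -- The three vertices of an isolated configuration are distinct.
  isolated-bound : 2 ≤ m → ∀ S a → Isolated S a → ∣ S ∣ + 3 ≤ suc m
  isolated-bound 2≤m S a (a∉S , a′∉S , a″∉S) =
    missing-bound (a ∷ next a ∷ next (next a) ∷ []) S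
      (distinct3 (λ e → next-moves 1≤m a (sym e)) (λ e → next²-moves 2≤m a (sym e))
                 (λ e → next-moves 1≤m (next a) (sym e)))
      (a∉S ∷ a′∉S ∷ a″∉S ∷ [])
    where
    1≤m : 1 ≤ m
    1≤m = ≤-trans (s≤s z≤n) 2≤m

  module WeakSubgraph (S : Subset (suc m)) where

    G : Vertex → Vertex → Set
    G = WeakSub (CycleAdj (suc m)) S

    G-sym : ∀ {u v} → G u v → G v u
    G-sym (adj , inj₁ u∈S) = CycleAdj-sym adj , inj₂ u∈S
    G-sym (adj , inj₂ v∈S) = CycleAdj-sym adj , inj₁ v∈S

    open Symmetric G G-sym

    -- The edge {a, next a} survives in G iff a is live; otherwise a is dead.
    Live Dead : Vertex → Set
    Live a = a ∈ S ⊎ next a ∈ S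
    Dead a = a ∉ S × next a ∉ S

    dead? : ∀ a → Dec (Dead a)
    dead? a = ¬? (a ∈? S) ×-dec ¬? (next a ∈? S)

    live-unless-dead : ∀ a → ¬ Dead a → Live a
    live-unless-dead a not-dead with a ∈? S | next a ∈? S
    ... | yes a∈S | _        = inj₁ a∈S
    ... | no  _   | yes a′∈S = inj₂ a′∈S
    ... | no  a∉S | no  a′∉S = ⊥-elim (not-dead (a∉S , a′∉S))

    walk : ∀ k x → (∀ i → i < k → Live (rot i x)) → Reach G x (rot k x)
    walk zero    x _    = subst (Reach G x) (sym (rot-zero x)) here
    walk (suc k) x live =
      step (adj-next x , subst Live (rot-zero x) (live 0 (s≤s z≤n)))
           (subst (Reach G (next x)) (rot-rot k 1 x) (walk k (next x) live-after-x))
      where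
      live-after-x : ∀ i → i < k → Live (rot i (next x))
      live-after-x i i<k = subst Live (sym (rot-rot i 1 x)) (live (suc i) (s≤s i<k))

    -- If every edge except possibly {c, next c} survives, G is connected: from
    -- next c every vertex is reached by walking forwards fewer than n steps,
    -- which never uses the edge at c.
    one-dead⇒connected : ∀ c → (∀ a → a ≢ c → Live a) → Connected G
    one-dead⇒connected c live = connected-from (next c) reach
      where
      reach : ∀ u → Reach G (next c) u
      reach u with rot-onto (next c) u
      ... | j , j<n , refl = walk j (next c) (λ i i<j → live (rot i (next c)) (avoids-c i i<j))
        where
        avoids-c : ∀ i → i < j → rot i (next c) ≢ c
        avoids-c i i<j e = 1+n≢0 (rot-fixed (suc i) c (≤-<-trans i<j j<n) (trans (sym (rot-rot i 1 c)) e))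

    -- An isolated configuration at a leaves next a without edges, so G is disconnected
    -- (for n ≥ 2, where next a ≠ a).
    isolated⇒disconnected : 1 ≤ m → ∀ a → Isolated S a → ¬ Connected G
    isolated⇒disconnected 1≤m a (a∉S , a′∉S , a″∉S) connected
      with first-edge (connected (next a) a) (next-moves 1≤m a)
    ... | v , adj , inS with adj⇒next adj | inS
    ... | _         | inj₁ a′∈S = a′∉S a′∈S
    ... | inj₁ refl | inj₂ v∈S  = a″∉S v∈S
    ... | inj₂ e    | inj₂ v∈S  = a∉S (subst (_∈ S) (sym (next-injective e)) v∈S)

    -- With at most three vertices missing and no isolated configuration, any
    -- two dead positions coincide: otherwise a, next a, b, next b are four
    -- distinct missing vertices.
    dead-unique : 1 ≤ m → suc m < ∣ S ∣ + 4 → (∀ a → ¬ Isolated S a) →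
                  ∀ {a b} → Dead a → Dead b → a ≡ b
    dead-unique 1≤m few no-isolated {a} {b} (a∉S , a′∉S) (b∉S , b′∉S) with a ≟ b | b ≟ next a | a ≟ next b
    ... | yes a≡b | _        | _        = a≡b
    ... | no _    | yes refl | _        = ⊥-elim (no-isolated a (a∉S , a′∉S , b′∉S))
    ... | no _    | no _     | yes refl = ⊥-elim (no-isolated b (b∉S , b′∉S , a′∉S))
    ... | no a≢b  | no b≢a′  | no a≢b′  = ⊥-elim (<⇒≱ few (missing-bound (a ∷ next a ∷ b ∷ next b ∷ []) S
            (distinct4 (λ e → next-moves 1≤m a (sym e)) a≢b a≢b′ (λ e → b≢a′ (sym e))
                       (λ e → a≢b (next-injective e)) (λ e → next-moves 1≤m b (sym e)))
            (a∉S ∷ a′∉S ∷ b∉S ∷ b′∉S ∷ [])))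

    wcds-criterion : 3 ≤ m → suc m < ∣ S ∣ + 4 → (∀ a → ¬ Isolated S a) → IsWCDS (CycleAdj (suc m)) S
    wcds-criterion 3≤m few no-isolated = nonempty-of-card S 0<∣S∣ , connected
      where
      1≤m : 1 ≤ m
      1≤m = ≤-trans (s≤s z≤n) 3≤m
      0<∣S∣ : 0 < ∣ S ∣
      0<∣S∣ = +-cancelʳ-< 4 0 ∣ S ∣ (≤-<-trans (s≤s 3≤m) few)
      connected : Connected G
      connected with any? dead?
      ... | yes (c , c-dead) = one-dead⇒connected c
              (λ a a≢c → live-unless-dead a (λ a-dead → a≢c (dead-unique 1≤m few no-isolated a-dead c-dead)))
      ... | no  none-dead    = one-dead⇒connected zero (λ a _ → live-unless-dead a (λ a-dead → none-dead (a , a-dead)))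

  -- gap a: all vertices except a, next a and next (next a).  These are the
  -- sets of size n - 3 that are not WCDSs.
  gap : Vertex → Subset (suc m)
  gap a = ⊤ - a - next a - next (next a)

  ∈gap⁺ : ∀ {a y} → y ≢ a → y ≢ next a → y ≢ next (next a) → y ∈ gap a
  ∈gap⁺ y≢a y≢a′ y≢a″ = x∈p∧x≢y⇒x∈p-y (x∈p∧x≢y⇒x∈p-y (x∈p∧x≢y⇒x∈p-y ∈⊤ y≢a) y≢a′) y≢a″

  ∈gap⁻ : ∀ {a y} → y ∈ gap a → y ≢ a × y ≢ next a × y ≢ next (next a)
  ∈gap⁻ {a} y∈ with ∈-remove⁻ (⊤ - a - next a) y∈
  ... | y∈₂ , y≢a″ with ∈-remove⁻ (⊤ - a) y∈₂
  ...   | y∈₁ , y≢a′ = proj₂ (∈-remove⁻ ⊤ y∈₁) , y≢a′ , y≢a″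

  gap-isolated : ∀ a → Isolated (gap a) a
  gap-isolated a = (λ a∈ → proj₁ (∈gap⁻ a∈) refl)
                 , (λ a′∈ → proj₁ (proj₂ (∈gap⁻ a′∈)) refl)
                 , (λ a″∈ → proj₂ (proj₂ (∈gap⁻ a″∈)) refl)

  ∉gap⁻ : ∀ {a y} → y ∉ gap a → Σ ℕ λ i → i < 3 × rot i a ≡ y
  ∉gap⁻ {a} {y} y∉ with y ≟ a | y ≟ next a | y ≟ next (next a)
  ... | yes refl | _        | _        = 0 , s≤s z≤n , rot-zero y
  ... | no _     | yes refl | _        = 1 , s≤s (s≤s z≤n) , refl
  ... | no _     | no _     | yes refl = 2 , ≤-refl , sym (rot-rot 1 1 a)
  ... | no y≢a   | no y≢a′  | no y≢a″  = ⊥-elim (y∉ (∈gap⁺ y≢a y≢a′ y≢a″))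

  -- gap a has n - 3 elements, since a, next a, next (next a) are distinct for n ≥ 3.
  gap-card : 2 ≤ m → ∀ a → ∣ gap a ∣ + 3 ≡ suc m
  gap-card 2≤m a = begin
    ∣ gap a ∣ + 3                  ≡⟨ +-comm ∣ gap a ∣ 3 ⟩
    suc (suc (suc ∣ gap a ∣))      ≡⟨ cong (λ t → suc (suc t)) (card-remove (⊤ - a - next a) a″∈) ⟩
    suc (suc ∣ ⊤ - a - next a ∣)   ≡⟨ cong suc (card-remove (⊤ - a) a′∈) ⟩
    suc ∣ ⊤ - a ∣                  ≡⟨ card-remove ⊤ (∈⊤ {x = a}) ⟩
    ∣ ⊤ {suc m} ∣                  ≡⟨ ∣⊤∣≡n (suc m) ⟩
    suc m                          ∎
    where
    open ≡-Reasoning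
    1≤m : 1 ≤ m
    1≤m = ≤-trans (s≤s z≤n) 2≤m
    a′∈ : next a ∈ ⊤ - a
    a′∈ = x∈p∧x≢y⇒x∈p-y ∈⊤ (next-moves 1≤m a)
    a″∈ : next (next a) ∈ ⊤ - a - next a
    a″∈ = x∈p∧x≢y⇒x∈p-y (x∈p∧x≢y⇒x∈p-y ∈⊤ (next²-moves 2≤m a)) (next-moves 1≤m (next a))

  -- For n ≥ 5 distinct vertices have distinct gaps: if b = rot i a and
  -- a = rot j b with i, j < 3, then rot (i + j) fixes a, so i + j = 0.
  gap-injective : 4 ≤ m → ∀ {a b} → gap a ≡ gap b → a ≡ b
  gap-injective 4≤m {a} {b} ga≡gb
    with ∉gap⁻ (λ b∈ga → proj₁ (gap-isolated b) (subst (b ∈_) ga≡gb b∈ga))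
       | ∉gap⁻ (λ a∈gb → proj₁ (gap-isolated a) (subst (a ∈_) (sym ga≡gb) a∈gb))
  ... | i , i<3 , rot-i-a≡b | j , j<3 , rot-j-b≡a =
    trans (sym (rot-zero a)) (subst (λ t → rot t a ≡ b) i≡0 rot-i-a≡b)
    where
    i+j<n : i + j < suc m
    i+j<n = s≤s (≤-trans (+-mono-≤ (s≤s⁻¹ i<3) (s≤s⁻¹ j<3)) 4≤m)
    i≡0 : i ≡ 0
    i≡0 = m+n≡0⇒m≡0 i (rot-fixed (i + j) a i+j<n
            (trans (sym (rot-rot j i a)) (trans (cong (rot j) rot-i-a≡b) rot-j-b≡a)))

  isolated⇒gap : 2 ≤ m → ∀ S a → suc m < ∣ S ∣ + 4 → Isolated S a → S ≡ gap a
  isolated⇒gap 2≤m S a few (a∉S , a′∉S , a″∉S) = ⊆-antisym S⊆gap gap⊆S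
    where
    1≤m : 1 ≤ m
    1≤m = ≤-trans (s≤s z≤n) 2≤m
    S⊆gap : ∀ {y} → y ∈ S → y ∈ gap a
    S⊆gap y∈S = ∈gap⁺ (λ { refl → a∉S y∈S }) (λ { refl → a′∉S y∈S }) (λ { refl → a″∉S y∈S })
    gap⊆S : ∀ {y} → y ∈ gap a → y ∈ S
    gap⊆S {y} y∈gap with y ∈? S | ∈gap⁻ y∈gap
    ... | yes y∈S | _ = y∈S
    ... | no  y∉S | y≢a , y≢a′ , y≢a″ = ⊥-elim (<⇒≱ few (missing-bound (y ∷ a ∷ next a ∷ next (next a) ∷ []) S
            (distinct4 y≢a y≢a′ y≢a″ (λ e → next-moves 1≤m a (sym e)) (λ e → next²-moves 2≤m a (sym e))
                       (λ e → next-moves 1≤m (next a) (sym e)))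
            (y∉S ∷ a∉S ∷ a′∉S ∷ a″∉S ∷ [])))

-- Part (i): sets of size at least n - 2

-- On C_n with n = suc m ≥ 4, every set with at least n - 2 vertices is a WCDS:
-- it misses at most two vertices, so it contains no isolated configuration.
large-set-is-wcds : ∀ m → 3 ≤ m → (S : Subset (suc m)) → m ∸ 1 ≤ ∣ S ∣ → IsWCDS (CycleAdj (suc m)) S
large-set-is-wcds m 3≤m S lo = wcds-criterion 3≤m few no-isolated
  where
  open Cycle m
  open WeakSubgraph S
  m≤1+∣S∣ : m ≤ suc ∣ S ∣
  m≤1+∣S∣ = ≤-trans (m≤n+m∸n m 1) (s≤s lo)
  few : suc m < ∣ S ∣ + 4
  few = subst (suc (suc m) ≤_) (+-comm 4 ∣ S ∣) (s≤s (s≤s (m≤n⇒m≤1+n m≤1+∣S∣)))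
  no-isolated : ∀ a → ¬ Isolated S a
  no-isolated a iso = 1+n≰n (≤-trans (s≤s⁻¹ three-missing) m≤1+∣S∣)
    where
    three-missing : suc (suc (suc ∣ S ∣)) ≤ suc m
    three-missing = subst (_≤ suc m) (+-comm ∣ S ∣ 3) (isolated-bound (≤-trans (s≤s (s≤s z≤n)) 3≤m) S a iso)

-- Hence d_w(C_n, i) = C(n, i) for i ≥ n - 2: the list of all i-subsets counts them.
count-large : ∀ m → 3 ≤ m → ∀ i → m ∸ 1 ≤ i → DwCount (CycleAdj (suc m)) i (suc m C i)
count-large m 3≤m i lo = subsets (suc m) i , unique-subsets (suc m) i , spec , length-subsets (suc m) i
  where
  spec : ∀ S → (S L.∈ subsets (suc m) i) ⇔ (IsWCDS (CycleAdj (suc m)) S × ∣ S ∣ ≡ i)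
  spec S = mk⇔ (λ S∈ → let card = ∈subsets⇒card (suc m) i S S∈
                       in large-set-is-wcds m 3≤m S (subst (m ∸ 1 ≤_) (sym card) lo) , card)
               (λ (_ , card) → card⇒∈subsets (suc m) i S card)

-- Part (ii): sets of size n - 3, for n = suc m ≥ 5.  Among the candidates,
-- the WCDSs are those without isolated configuration and the others are the
-- n distinct gaps.

module ThreeMissing (m : ℕ) (4≤m : 4 ≤ m) where
  open Cycle m

  2≤m : 2 ≤ m
  2≤m = ≤-trans (s≤s (s≤s z≤n)) 4≤m

  few : ∀ (S : Subset (suc m)) → ∣ S ∣ ≡ m ∸ 2 → suc m < ∣ S ∣ + 4
  few S card = subst (λ s → suc m < s + 4) (sym card) (≤-reflexive (sym (begin
    m ∸ 2 + 4        ≡⟨ +-assoc (m ∸ 2) 2 2 ⟨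
    m ∸ 2 + 2 + 2    ≡⟨ cong (_+ 2) (m∸n+n≡m 2≤m) ⟩
    m + 2            ≡⟨ +-comm m 2 ⟩
    suc (suc m)      ∎)))
    where open ≡-Reasoning

  candidates good bad : List (Subset (suc m))
  candidates = subsets (suc m) (m ∸ 2)
  good       = filter (λ S → ¬? (isolated? S)) candidates
  bad        = filter isolated? candidates

  good-spec : ∀ S → (S L.∈ good) ⇔ (IsWCDS (CycleAdj (suc m)) S × ∣ S ∣ ≡ m ∸ 2)
  good-spec S = mk⇔ to from
    where
    open WeakSubgraph S
    to : S L.∈ good → IsWCDS (CycleAdj (suc m)) S × ∣ S ∣ ≡ m ∸ 2
    to S∈ with ∈-filter⁻ (λ T → ¬? (isolated? T)) {xs = candidates} S∈
    ... | S∈cand , no-isolated =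
      let card = ∈subsets⇒card (suc m) (m ∸ 2) S S∈cand
      in wcds-criterion (<⇒≤ 4≤m) (few S card) (λ a iso → no-isolated (a , iso)) , card
    from : IsWCDS (CycleAdj (suc m)) S × ∣ S ∣ ≡ m ∸ 2 → S L.∈ good
    from ((_ , connected) , card) =
      ∈-filter⁺ (λ T → ¬? (isolated? T)) (card⇒∈subsets (suc m) (m ∸ 2) S card)
        (λ (a , iso) → isolated⇒disconnected (≤-trans (s≤s z≤n) 2≤m) a iso connected)

  -- bad lists the same sets as the n distinct gaps.
  length-bad : length bad ≡ suc m
  length-bad = trans (unique-same-length (Unique.filter⁺ isolated? (unique-subsets (suc m) (m ∸ 2)))
                                         (Unique.tabulate⁺ (gap-injective 4≤m)) bad⊆gaps gaps⊆bad)
                     (length-tabulate gap)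
    where
    bad⊆gaps : ∀ S → S L.∈ bad → S L.∈ tabulate gap
    bad⊆gaps S S∈ with ∈-filter⁻ isolated? {xs = candidates} S∈
    ... | S∈cand , (a , iso) =
      subst (L._∈ tabulate gap)
            (sym (isolated⇒gap 2≤m S a (few S (∈subsets⇒card (suc m) (m ∸ 2) S S∈cand)) iso))
            (∈-tabulate⁺ {f = gap} a)
    gaps⊆bad : ∀ S → S L.∈ tabulate gap → S L.∈ bad
    gaps⊆bad S S∈ with ∈-tabulate⁻ {f = gap} S∈
    ... | a , refl = ∈-filter⁺ isolated? (card⇒∈subsets (suc m) (m ∸ 2) (gap a) card) (a , gap-isolated a)
      where
      card : ∣ gap a ∣ ≡ m ∸ 2
      card = trans (sym (m+n∸n≡m ∣ gap a ∣ 3)) (cong (_∸ 3) (gap-card 2≤m a))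

  length-good : length good ≡ suc m C (m ∸ 2) ∸ suc m
  length-good = begin
    length good                                    ≡⟨ m+n∸n≡m (length good) (suc m) ⟨
    length good + suc m ∸ suc m                    ≡⟨ cong (λ t → length good + t ∸ suc m) length-bad ⟨
    length good + length bad ∸ suc m               ≡⟨ cong (_∸ suc m) split ⟩
    suc m C (m ∸ 2) ∸ suc m                        ∎
    where
    open ≡-Reasoning
    split : length good + length bad ≡ suc m C (m ∸ 2)
    split = trans (+-comm (length good) (length bad))
                  (trans (length-filter-split isolated? candidates) (length-subsets (suc m) (m ∸ 2)))

  count : DwCount (CycleAdj (suc m)) (m ∸ 2) (suc m C (m ∸ 2) ∸ suc m)
  count = good , Unique.filter⁺ (λ S → ¬? (isolated? S)) (unique-subsets (suc m) (m ∸ 2)) , good-spec , length-good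

-- Arithmetic: C(n, n - 3) - n = (n + 1) n (n - 4) / 6.

choose2 : ∀ n → 2 * (suc n C 2) ≡ suc n * n
choose2 zero    = refl
choose2 (suc n) = begin
  2 * (suc (suc n) C 2)           ≡⟨ cong (2 *_) (nCk+nC[k+1]≡[n+1]C[k+1] (suc n) 1) ⟨
  2 * (suc n C 1 + suc n C 2)     ≡⟨ cong (λ t → 2 * (t + suc n C 2)) (nC1≡n (suc n)) ⟩
  2 * (suc n + suc n C 2)         ≡⟨ *-distribˡ-+ 2 (suc n) (suc n C 2) ⟩
  2 * suc n + 2 * (suc n C 2)     ≡⟨ cong (2 * suc n +_) (choose2 n) ⟩
  2 * suc n + suc n * n           ≡⟨ expand n ⟩
  suc (suc n) * suc n             ∎
  where
  open ≡-Reasoning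
  expand : ∀ n → 2 * suc n + suc n * n ≡ suc (suc n) * suc n
  expand = solve-∀

choose3 : ∀ n → 6 * (suc (suc n) C 3) ≡ suc (suc n) * suc n * n
choose3 zero    = refl
choose3 (suc n) = begin
  6 * (suc (suc (suc n)) C 3)                           ≡⟨ cong (6 *_) (nCk+nC[k+1]≡[n+1]C[k+1] (suc (suc n)) 2) ⟨
  6 * (suc (suc n) C 2 + suc (suc n) C 3)               ≡⟨ *-distribˡ-+ 6 (suc (suc n) C 2) (suc (suc n) C 3) ⟩
  6 * (suc (suc n) C 2) + 6 * (suc (suc n) C 3)         ≡⟨ cong₂ _+_ six-C2 (choose3 n) ⟩
  3 * (suc (suc n) * suc n) + suc (suc n) * suc n * n   ≡⟨ expand n ⟩
  suc (suc (suc n)) * suc (suc n) * suc n               ∎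
  where
  open ≡-Reasoning
  six-C2 : 6 * (suc (suc n) C 2) ≡ 3 * (suc (suc n) * suc n)
  six-C2 = trans (*-assoc 3 2 (suc (suc n) C 2)) (cong (3 *_) (choose2 (suc n)))
  expand : ∀ n → 3 * (suc (suc n) * suc n) + suc (suc n) * suc n * n ≡ suc (suc (suc n)) * suc (suc n) * suc n
  expand = solve-∀

-- With n = 6 + j: 6·C(n,3) = n(n-1)(n-2) = (n+1)n(n-4) + 6n.
three-missing-formula : ∀ j → (6 + j) C (3 + j) ∸ (6 + j) ≡ (suc (6 + j) * (6 + j) * (2 + j)) / 6
three-missing-formula j = begin
  c ∸ n              ≡⟨ m*n/n≡m (c ∸ n) 6 ⟨
  (c ∸ n) * 6 / 6    ≡⟨ cong (_/ 6) times6 ⟩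
  suc n * n * (2 + j) / 6 ∎
  where
  open ≡-Reasoning
  n : ℕ
  n = 6 + j
  c : ℕ
  c = n C (3 + j)
  symmetric : c ≡ n C 3
  symmetric = trans (nCk≡nC[n∸k] (m≤n+m (3 + j) 3)) (cong (n C_) (m∸[m∸n]≡n {n} {3} (m≤m+n 3 (3 + j))))
  expand : ∀ j → (6 + j) * (5 + j) * (4 + j) ≡ suc (6 + j) * (6 + j) * (2 + j) + (6 + j) * 6
  expand = solve-∀
  times6 : (c ∸ n) * 6 ≡ suc n * n * (2 + j)
  times6 = begin
    (c ∸ n) * 6                          ≡⟨ *-distribʳ-∸ 6 c n ⟩
    c * 6 ∸ n * 6                        ≡⟨ cong (λ t → t * 6 ∸ n * 6) symmetric ⟩
    (n C 3) * 6 ∸ n * 6                  ≡⟨ cong (_∸ n * 6) (trans (*-comm (n C 3) 6) (choose3 (4 + j))) ⟩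
    n * (5 + j) * (4 + j) ∸ n * 6        ≡⟨ cong (_∸ n * 6) (expand j) ⟩
    suc n * n * (2 + j) + n * 6 ∸ n * 6  ≡⟨ m+n∸n≡m (suc n * n * (2 + j)) (n * 6) ⟩
    suc n * n * (2 + j)                  ∎

lemma4p2 : ((n : ℕ) → 4 ≤ n → (i : ℕ) → n ∸ 2 ≤ i → i ≤ n → DwCount (CycleAdj n) i (n C i))
    × ((n : ℕ) → 6 ≤ n → DwCount (CycleAdj n) (n ∸ 3) ((suc n * n * (n ∸ 4)) / 6))
lemma4p2 = part-i , part-ii
  where
  part-i : (n : ℕ) → 4 ≤ n → (i : ℕ) → n ∸ 2 ≤ i → i ≤ n → DwCount (CycleAdj n) i (n C i)
  part-i (suc m) (s≤s 3≤m) i n-2≤i _ = count-large m 3≤m i n-2≤i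
  part-ii : (n : ℕ) → 6 ≤ n → DwCount (CycleAdj n) (n ∸ 3) ((suc n * n * (n ∸ 4)) / 6)
  part-ii .(6 + j) (s≤s (s≤s (s≤s (s≤s (s≤s (s≤s {n = j} _)))))) =
    subst (DwCount (CycleAdj (6 + j)) (3 + j)) (three-missing-formula j)
          (ThreeMissing.count (5 + j) (s≤s (s≤s (s≤s (s≤s z≤n)))))
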